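{- Let $G$ be a finite group and $m>1$. If $\mathbf{g},\mathbf{h}\in G^m\setminus\{\mathbf{e}\}$ are adjacent in $\mathscr{G}_m(G)$, then $|\vartheta(\mathbf{g})-\vartheta(\mathbf{h})|\leqslant2$.
   Context: For a finite group $G$ with identity $e$, $G^\times=G\setminus\{e\}$, $\mathbf{e}=(e,\dots,e)$. For $x\in G^\times$ and $1\leqslant k<l\leqslant m+1$, $\mathbf{x}_{[k,l)}\in G^m$ has $j$-th coordinate $x$ for $k\leqslant j<l$ and $e$ otherwise; $\mathcal{S}$ is the set of all such $\mathbf{x}_{[k,l)}$, and $\mathscr{G}_m(G)=Cay(G^m,\mathcal{S})$ is the graph on $G^m$ with $\mathbf{g}\sim\mathbf{h}$ iff $\mathbf{h}\mathbf{g}^{ -1}\in\mathcal{S}$. Every $\mathbf{g}\in G^m\setminus\{\mathbf{e}\}$ has a unique decomposition $\mathbf{g}={(\mathbf{x}_1)}_{[i_1,i_2)}{(\mathbf{x}_2)}_{[i_2,i_3)}\cdots{(\mathbf{x}_k)}_{[i_k,i_{k+1})}$ with $1\leqslant i_1<\dots<i_{k+1}\leqslant m+1$, $x_1,\dots,x_k\in G$, $x_1\neq e\neq x_k$ and $x_i\neq x_{i+1}$ for all $i$ (here for $x=e$ the factor is the identity tuple); the weight $\vartheta(\mathbf{g})$ is this number $k$. Equivalently, if $p$ and $q$ are the smallest and largest indices with $g_p\neq e$, $g_q\neq e$, then $\vartheta(\mathbf{g})=1+\#\{j: p\leqslant j<q,\ g_j\neq g_{j+1}\}$. -}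

module Defs where

open import Level using (Level)
open import Algebra.Bundles using (Group)
open import Data.Nat using (ℕ; zero; suc; _+_; _≤_; _<_)
open import Data.Fin using (Fin; toℕ)
open import Data.List using (List; []; _∷_; reverse)
open import Data.Vec.Functional using (Vector; toList)
open import Data.Product using (Σ; ∃; _×_)
open import Relation.Nullary using (¬_; yes; no)
open import Relation.Binary using (Decidable)

IsFinite : ∀ {c ℓ} (G : Group c ℓ) → Set (c Level.⊔ ℓ)
IsFinite G = Σ ℕ λ n → Σ (Fin n → Carrier) λ enum → ∀ x → ∃ λ i → enum i ≈ x
  where open Group G

module WithGroup {c ℓ} (G : Group c ℓ) (_≟_ : Decidable (Group._≈_ G)) where
  open Group G

  -- S-membership: t = x_{[k,l)} (0-indexed positions k ≤ j < l, with k < l ≤ m), x ≠ e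
  InS : ∀ {m} → Vector Carrier m → Set (c Level.⊔ ℓ)
  InS {m} t = Σ Carrier λ x → ¬ (x ≈ ε) × Σ ℕ λ k → Σ ℕ λ l → (k < l) × (l ≤ m) ×
              (∀ (j : Fin m) → (k ≤ toℕ j → toℕ j < l → t j ≈ x)
                             × (¬ (k ≤ toℕ j × toℕ j < l) → t j ≈ ε))

  -- adjacency in the Cayley graph Cay(G^m, S): h g⁻¹ ∈ S (coordinatewise)
  Adjacent : ∀ {m} → Vector Carrier m → Vector Carrier m → Set (c Level.⊔ ℓ)
  Adjacent g h = InS (λ j → h j ∙ (g j ⁻¹))

  IsIdentity : ∀ {m} → Vector Carrier m → Set ℓ
  IsIdentity g = ∀ j → g j ≈ ε

  dropE : List Carrier → List Carrier
  dropE [] = []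
  dropE (x ∷ xs) with x ≟ ε
  ... | yes _ = dropE xs
  ... | no _ = x ∷ xs

  -- the segment g_p … g_q between the first and last non-identity entries
  core : List Carrier → List Carrier
  core xs = reverse (dropE (reverse (dropE xs)))

  changesFrom : Carrier → List Carrier → ℕ
  changesFrom x [] = 0
  changesFrom x (y ∷ xs) with x ≟ y
  ... | yes _ = changesFrom y xs
  ... | no _ = suc (changesFrom y xs)

  changes : List Carrier → ℕ
  changes [] = 0
  changes (x ∷ xs) = changesFrom x xs

  -- weight ϑ(g) = 1 + #{ j : p ≤ j < q, g_j ≠ g_{j+1} }  (0 for the identity tuple)
  weightL : List Carrier → ℕ
  weightL xs with core xs
  ... | [] = 0
  ... | ys@(_ ∷ _) = suc (changes ys)

  ϑ : ∀ {m} → Vector Carrier m → ℕ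
  ϑ g = weightL (toList g)

-- Pad g with the identity at both ends: for g ≠ e, ϑ(g) + 1 is the number of
-- indices at which the padded sequence e, g₁, …, gₘ, e changes value.  If h is
-- adjacent to g then h = x_{[k,l)} g, i.e. h agrees with g off the segment [k,l)
-- and with x g on it.  Left multiplication by x preserves (in)equality of
-- neighbours, so only the two transitions across the ends of the segment can
-- differ, and each changes the count by at most one.
module Submission where

open import Defs
open import Algebra.Bundles using (Group)
open import Data.Nat using (ℕ; _≤_; _<_; ∣_-_∣)
open import Data.Vec.Functional using (Vector)
open import Relation.Nullary using (¬_)
open import Relation.Binary using (Decidable)

import Algebra.Properties.Group as GroupProperties
open import Data.Fin using (toℕ; zero; suc)
open import Data.List using (List; []; _∷_; _++_; reverse; reverseAcc; length)
open import Data.List.Properties using (reverse-++; length-reverse; ++-identityʳ)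
open import Data.List.Relation.Binary.Pointwise as Pointwise using (Pointwise; []; _∷_)
open import Data.List.Relation.Unary.Any using (Any; here; there)
open import Data.List.Relation.Unary.Any.Properties using (reverse⁺)
open import Data.Nat using (zero; suc; _+_; z≤n; s≤s)
open import Data.Nat.Properties
  using (≤-refl; ≤-reflexive; ≤-trans; ≤-pred; +-mono-≤; +-comm; +-assoc; +-identityʳ; 0≢1+n;
         ∣-∣-triangle; ∣m+n-m+o∣≡∣n-o∣; m≡n⇒∣m-n∣≡0; ∣n-n∣≡0; module ≤-Reasoning)
open import Data.Product using (Σ-syntax; _×_; _,_; proj₁; proj₂)
open import Data.Vec.Functional using (toList; tail)
open import Function using (_∘_)
open import Level using (_⊔_)
open import Relation.Binary.PropositionalEquality as ≡
  using (_≡_; refl; cong; cong₂; subst; subst₂; module ≡-Reasoning)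
open import Relation.Nullary using (yes; no; contradiction)

∣m+n-o+p∣≤∣m-o∣+∣n-p∣ : ∀ m n o p → ∣ m + n - o + p ∣ ≤ ∣ m - o ∣ + ∣ n - p ∣
∣m+n-o+p∣≤∣m-o∣+∣n-p∣ m n o p = begin
  ∣ m + n - o + p ∣                 ≤⟨ ∣-∣-triangle (m + n) (o + n) (o + p) ⟩
  ∣ m + n - o + n ∣ + ∣ o + n - o + p ∣
    ≡⟨ cong₂ (λ u v → ∣ u - v ∣ + ∣ o + n - o + p ∣) (+-comm m n) (+-comm o n) ⟩
  ∣ n + m - n + o ∣ + ∣ o + n - o + p ∣
    ≡⟨ cong₂ _+_ (∣m+n-m+o∣≡∣n-o∣ n m o) (∣m+n-m+o∣≡∣n-o∣ o n p) ⟩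
  ∣ m - o ∣ + ∣ n - p ∣             ∎
  where open ≤-Reasoning

module Changes {c ℓ} (G : Group c ℓ) (_≟_ : Decidable (Group._≈_ G)) where
  open Group G renaming (refl to ≈-refl; sym to ≈-sym; trans to ≈-trans)
  open GroupProperties G using (∙-cancelˡ; //-rightDividesˡ; x∙y⁻¹≈ε⇒x≈y)
  open WithGroup G _≟_

  change : Carrier → Carrier → ℕ
  change a b with a ≟ b
  ... | yes _ = 0
  ... | no  _ = 1

  change-resp : ∀ {a b a′ b′} → (a ≈ b → a′ ≈ b′) → (a′ ≈ b′ → a ≈ b) → change a b ≡ change a′ b′
  change-resp {a} {b} {a′} {b′} to from with a ≟ b | a′ ≟ b′
  ... | yes _   | yes _   = refl
  ... | no  _   | no  _   = refl
  ... | yes a≈b | no a′≉b′ = contradiction (to a≈b) a′≉b′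
  ... | no a≉b  | yes a′≈b′ = contradiction (from a′≈b′) a≉b

  change-cong : ∀ {a b a′ b′} → a ≈ a′ → b ≈ b′ → change a b ≡ change a′ b′
  change-cong a≈a′ b≈b′ =
    change-resp (λ e → ≈-trans (≈-sym a≈a′) (≈-trans e b≈b′))
                (λ e → ≈-trans a≈a′ (≈-trans e (≈-sym b≈b′)))

  change-sym : ∀ a b → change a b ≡ change b a
  change-sym a b = change-resp ≈-sym ≈-sym

  change-∙ˡ : ∀ x a b → change (x ∙ a) (x ∙ b) ≡ change a b
  change-∙ˡ x a b = change-resp (∙-cancelˡ x a b) ∙-congˡ

  change-≈ : ∀ {a b} → a ≈ b → change a b ≡ 0
  change-≈ {a} {b} a≈b with a ≟ b
  ... | yes _   = refl
  ... | no a≉b = contradiction a≈b a≉b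

  ∣change-change∣≤1 : ∀ a b a′ b′ → ∣ change a b - change a′ b′ ∣ ≤ 1
  ∣change-change∣≤1 a b a′ b′ with a ≟ b | a′ ≟ b′
  ... | yes _ | yes _ = z≤n
  ... | yes _ | no  _ = ≤-refl
  ... | no  _ | yes _ = ≤-refl
  ... | no  _ | no  _ = z≤n

  changesFrom-∷ : ∀ a b xs → changesFrom a (b ∷ xs) ≡ change a b + changesFrom b xs
  changesFrom-∷ a b xs with a ≟ b
  ... | yes _ = refl
  ... | no  _ = refl

  changesFrom-ε-≉ : ∀ {b} xs → b ≉ ε → changesFrom ε (b ∷ xs) ≡ suc (changesFrom b xs)
  changesFrom-ε-≉ {b} xs b≉ε with ε ≟ b
  ... | yes ε≈b = contradiction (≈-sym ε≈b) b≉ε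
  ... | no  _   = refl

  changesFrom-cong : ∀ {a a′ xs ys} → a ≈ a′ → Pointwise _≈_ xs ys → changesFrom a xs ≡ changesFrom a′ ys
  changesFrom-cong a≈a′ [] = refl
  changesFrom-cong {a} {a′} {b ∷ xs} {b′ ∷ ys} a≈a′ (b≈b′ ∷ xs≈ys) = begin
    changesFrom a (b ∷ xs)              ≡⟨ changesFrom-∷ a b xs ⟩
    change a b + changesFrom b xs       ≡⟨ cong₂ _+_ (change-cong a≈a′ b≈b′) (changesFrom-cong b≈b′ xs≈ys) ⟩
    change a′ b′ + changesFrom b′ ys    ≡⟨ changesFrom-∷ a′ b′ ys ⟨
    changesFrom a′ (b′ ∷ ys)            ∎
    where open ≡-Reasoning

  ∣changesFrom-∷-changesFrom-∷∣≤ : ∀ a b xs a′ b′ ys →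
    ∣ changesFrom a (b ∷ xs) - changesFrom a′ (b′ ∷ ys) ∣ ≤
    ∣ change a b - change a′ b′ ∣ + ∣ changesFrom b xs - changesFrom b′ ys ∣
  ∣changesFrom-∷-changesFrom-∷∣≤ a b xs a′ b′ ys =
    ≤-trans (≤-reflexive (cong₂ ∣_-_∣ (changesFrom-∷ a b xs) (changesFrom-∷ a′ b′ ys)))
            (∣m+n-o+p∣≤∣m-o∣+∣n-p∣ (change a b) (changesFrom b xs) (change a′ b′) (changesFrom b′ ys))

  ∣changesFrom-changesFrom∣≤1 : ∀ a a′ xs → ∣ changesFrom a xs - changesFrom a′ xs ∣ ≤ 1
  ∣changesFrom-changesFrom∣≤1 a a′ []       = z≤n
  ∣changesFrom-changesFrom∣≤1 a a′ (b ∷ xs) =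
    ≤-trans (∣changesFrom-∷-changesFrom-∷∣≤ a b xs a′ b xs)
            (+-mono-≤ (∣change-change∣≤1 a b a′ b) (≤-reflexive (∣n-n∣≡0 (changesFrom b xs))))

  data TranslatedPrefix (x : Carrier) : List Carrier → List Carrier → Set (c ⊔ ℓ) where
    equal : ∀ {xs ys} → Pointwise _≈_ xs ys → TranslatedPrefix x xs ys
    _∷_   : ∀ {b b′ xs ys} → b′ ≈ x ∙ b → TranslatedPrefix x xs ys → TranslatedPrefix x (b ∷ xs) (b′ ∷ ys)

  data TranslatedSegment (x : Carrier) : List Carrier → List Carrier → Set (c ⊔ ℓ) where
    prefix : ∀ {xs ys} → TranslatedPrefix x xs ys → TranslatedSegment x xs ys
    _∷_    : ∀ {b b′ xs ys} → b ≈ b′ → TranslatedSegment x xs ys → TranslatedSegment x (b ∷ xs) (b′ ∷ ys)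

  ∣changesFrom-changesFrom∣≤1-translatedPrefix : ∀ {x a a′ xs ys} → TranslatedPrefix x xs ys → a′ ≈ x ∙ a →
    ∣ changesFrom a xs - changesFrom a′ ys ∣ ≤ 1
  ∣changesFrom-changesFrom∣≤1-translatedPrefix {a = a} {a′} {xs} (equal xs≈ys) _ =
    subst (λ n → ∣ changesFrom a xs - n ∣ ≤ 1) (changesFrom-cong ≈-refl xs≈ys)
          (∣changesFrom-changesFrom∣≤1 a a′ xs)
  ∣changesFrom-changesFrom∣≤1-translatedPrefix {x} {a} {a′} (_∷_ {b} {b′} {xs} {ys} b′≈xb p) a′≈xa =
    ≤-trans (∣changesFrom-∷-changesFrom-∷∣≤ a b xs a′ b′ ys)
            (+-mono-≤ (≤-reflexive (m≡n⇒∣m-n∣≡0 same-change))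
                      (∣changesFrom-changesFrom∣≤1-translatedPrefix p b′≈xb))
    where
    same-change : change a b ≡ change a′ b′
    same-change = ≡.sym (≡.trans (change-cong a′≈xa b′≈xb) (change-∙ˡ x a b))

  ∣changesFrom-changesFrom∣≤2-translatedSegment : ∀ {x a a′ xs ys} → TranslatedSegment x xs ys → a ≈ a′ →
    ∣ changesFrom a xs - changesFrom a′ ys ∣ ≤ 2
  -- Re-heading ys at x ∙ a pays for the transition into the segment, the prefix lemma
  -- for the transition out of it.
  ∣changesFrom-changesFrom∣≤2-translatedSegment {x} {a} {a′} {xs} {ys} (prefix p) _ =
    ≤-trans (∣-∣-triangle (changesFrom a xs) (changesFrom (x ∙ a) ys) (changesFrom a′ ys))
            (+-mono-≤ (∣changesFrom-changesFrom∣≤1-translatedPrefix p ≈-refl)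
                      (∣changesFrom-changesFrom∣≤1 (x ∙ a) a′ ys))
  ∣changesFrom-changesFrom∣≤2-translatedSegment {a = a} {a′} (_∷_ {b} {b′} {xs} {ys} b≈b′ s) a≈a′ =
    ≤-trans (∣changesFrom-∷-changesFrom-∷∣≤ a b xs a′ b′ ys)
            (+-mono-≤ (≤-reflexive (m≡n⇒∣m-n∣≡0 (change-cong a≈a′ b≈b′)))
                      (∣changesFrom-changesFrom∣≤2-translatedSegment s b≈b′))

  changes-reverseAcc : ∀ a acc xs →
    changes (reverseAcc (a ∷ acc) xs) ≡ changesFrom a xs + changes (a ∷ acc)
  changes-reverseAcc a acc []       = refl
  changes-reverseAcc a acc (b ∷ xs) = begin
    changes (reverseAcc (b ∷ a ∷ acc) xs)                   ≡⟨ changes-reverseAcc b (a ∷ acc) xs ⟩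
    changesFrom b xs + changesFrom b (a ∷ acc)               ≡⟨ cong (changesFrom b xs +_) (changesFrom-∷ b a acc) ⟩
    changesFrom b xs + (change b a + changes (a ∷ acc))      ≡⟨ +-assoc (changesFrom b xs) _ _ ⟨
    changesFrom b xs + change b a + changes (a ∷ acc)        ≡⟨ cong (_+ changes (a ∷ acc)) (+-comm (changesFrom b xs) _) ⟩
    change b a + changesFrom b xs + changes (a ∷ acc)        ≡⟨ cong (λ d → d + changesFrom b xs + changes (a ∷ acc)) (change-sym b a) ⟩
    change a b + changesFrom b xs + changes (a ∷ acc)        ≡⟨ cong (_+ changes (a ∷ acc)) (changesFrom-∷ a b xs) ⟨
    changesFrom a (b ∷ xs) + changes (a ∷ acc)               ∎
    where open ≡-Reasoning

  changes-reverse : ∀ xs → changes (reverse xs) ≡ changes xs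
  changes-reverse []       = refl
  changes-reverse (a ∷ xs) = ≡.trans (changes-reverseAcc a [] xs) (+-identityʳ (changesFrom a xs))

  changesFrom-ε-dropE : ∀ xs ys → changesFrom ε (dropE xs ++ ys) ≡ changesFrom ε (xs ++ ys)
  changesFrom-ε-dropE []       ys = refl
  changesFrom-ε-dropE (b ∷ xs) ys with b ≟ ε
  ... | no  _   = refl
  ... | yes b≈ε = begin
    changesFrom ε (dropE xs ++ ys)        ≡⟨ changesFrom-ε-dropE xs ys ⟩
    changesFrom ε (xs ++ ys)              ≡⟨ changesFrom-cong (≈-sym b≈ε) (Pointwise.refl ≈-refl {xs ++ ys}) ⟩
    changesFrom b (xs ++ ys)              ≡⟨ cong (_+ changesFrom b (xs ++ ys)) (change-≈ (≈-sym b≈ε)) ⟨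
    change ε b + changesFrom b (xs ++ ys) ≡⟨ changesFrom-∷ ε b (xs ++ ys) ⟨
    changesFrom ε (b ∷ xs ++ ys)          ∎
    where open ≡-Reasoning

  dropE-≉ε : ∀ {xs} → Any (_≉ ε) xs → Σ[ b ∈ Carrier ] Σ[ ys ∈ List Carrier ] dropE xs ≡ b ∷ ys × b ≉ ε
  dropE-≉ε {b ∷ xs} b∷xs≉ε with b ≟ ε | b∷xs≉ε
  ... | no  b≉ε | _         = b , xs , refl , b≉ε
  ... | yes b≈ε | here b≉ε  = contradiction b≈ε b≉ε
  ... | yes _   | there xs≉ε = dropE-≉ε xs≉ε

  weightL-reverse-∷ : ∀ xs {b ys} → core xs ≡ reverse (b ∷ ys) → weightL xs ≡ suc (changes (b ∷ ys))
  weightL-reverse-∷ xs {b} {ys} core≡ with core xs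
  ... | []    = contradiction (≡.trans (cong length core≡) (length-reverse (b ∷ ys))) 0≢1+n
  ... | _ ∷ _ = cong suc (≡.trans (cong changes core≡) (changes-reverse (b ∷ ys)))

  paddedChanges : List Carrier → ℕ
  paddedChanges xs = changes (ε ∷ xs ++ ε ∷ [])

  suc-weightL≡paddedChanges : ∀ xs → Any (_≉ ε) xs → suc (weightL xs) ≡ paddedChanges xs
  suc-weightL≡paddedChanges xs xs≉ε
    with b , ys , dropE-xs , b≉ε ← dropE-≉ε xs≉ε
    with d , zs , dropE-rev , d≉ε ← dropE-≉ε (reverse⁺ {xs = b ∷ ys} (here b≉ε)) = begin
    suc (weightL xs)                               ≡⟨ cong suc (weightL-reverse-∷ xs {d} {zs} core-xs) ⟩
    suc (suc (changes (d ∷ zs)))                   ≡⟨ cong suc (changesFrom-ε-≉ zs d≉ε) ⟨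
    suc (changesFrom ε (d ∷ zs))                   ≡⟨ cong (suc ∘ changesFrom ε) (≡.trans (++-identityʳ _) dropE-rev) ⟨
    suc (changesFrom ε (dropE rev ++ []))          ≡⟨ cong suc (changesFrom-ε-dropE rev []) ⟩
    suc (changesFrom ε (rev ++ []))                ≡⟨ cong (suc ∘ changesFrom ε) (++-identityʳ rev) ⟩
    suc (changesFrom ε rev)                        ≡⟨ cong (suc ∘ changes) (reverse-++ (b ∷ ys) (ε ∷ [])) ⟨
    suc (changes (reverse (b ∷ ys ++ ε ∷ [])))     ≡⟨ cong suc (changes-reverse (b ∷ ys ++ ε ∷ [])) ⟩
    suc (changes (b ∷ ys ++ ε ∷ []))               ≡⟨ changesFrom-ε-≉ (ys ++ ε ∷ []) b≉ε ⟨
    changesFrom ε (b ∷ ys ++ ε ∷ [])               ≡⟨ cong (λ ws → changesFrom ε (ws ++ ε ∷ [])) dropE-xs ⟨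
    changesFrom ε (dropE xs ++ ε ∷ [])             ≡⟨ changesFrom-ε-dropE xs (ε ∷ []) ⟩
    paddedChanges xs                               ∎
    where
    open ≡-Reasoning
    rev = reverse (b ∷ ys)
    core-xs : core xs ≡ reverse (d ∷ zs)
    core-xs = ≡.trans (cong (λ ws → reverse (dropE (reverse ws))) dropE-xs) (cong reverse dropE-rev)

  ¬IsIdentity⇒Any≉ε : ∀ {m} (g : Vector Carrier m) → ¬ IsIdentity g → Any (_≉ ε) (toList g)
  ¬IsIdentity⇒Any≉ε {zero}  g g≉e = contradiction (λ ()) g≉e
  ¬IsIdentity⇒Any≉ε {suc m} g g≉e with g zero ≟ ε
  ... | no  g₀≉ε = here g₀≉ε
  ... | yes g₀≈ε = there (¬IsIdentity⇒Any≉ε (tail g) λ tail≈e → g≉e λ { zero → g₀≈ε ; (suc j) → tail≈e j })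

  x∙y⁻¹≈z⇒x≈z∙y : ∀ {x y z} → x ∙ y ⁻¹ ≈ z → x ≈ z ∙ y
  x∙y⁻¹≈z⇒x≈z∙y {x} {y} x∙y⁻¹≈z = ≈-trans (≈-sym (//-rightDividesˡ y x)) (∙-congʳ x∙y⁻¹≈z)

  x∙y⁻¹≈ε⇒y≈x : ∀ {x y} → x ∙ y ⁻¹ ≈ ε → y ≈ x
  x∙y⁻¹≈ε⇒y≈x {x} {y} x∙y⁻¹≈ε = ≈-sym (x∙y⁻¹≈ε⇒x≈y x y x∙y⁻¹≈ε)

  pointwise-padded : ∀ {m} (g h : Vector Carrier m) → (∀ j → h j ∙ g j ⁻¹ ≈ ε) →
    Pointwise _≈_ (toList g ++ ε ∷ []) (toList h ++ ε ∷ [])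
  pointwise-padded {zero}  g h h≈g = ≈-refl ∷ []
  pointwise-padded {suc m} g h h≈g =
    x∙y⁻¹≈ε⇒y≈x (h≈g zero) ∷ pointwise-padded (tail g) (tail h) (h≈g ∘ suc)

  translatedPrefix-padded : ∀ {m} x l (g h : Vector Carrier m) →
    (∀ j → (toℕ j < l → h j ∙ g j ⁻¹ ≈ x) × (¬ toℕ j < l → h j ∙ g j ⁻¹ ≈ ε)) →
    TranslatedPrefix x (toList g ++ ε ∷ []) (toList h ++ ε ∷ [])
  translatedPrefix-padded x zero g h onS = equal (pointwise-padded g h λ j → proj₂ (onS j) λ ())
  translatedPrefix-padded {zero}  x (suc l) g h onS = equal (≈-refl ∷ [])
  translatedPrefix-padded {suc m} x (suc l) g h onS =
    x∙y⁻¹≈z⇒x≈z∙y (proj₁ (onS zero) (s≤s z≤n)) ∷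
    translatedPrefix-padded x l (tail g) (tail h)
      λ j → proj₁ (onS (suc j)) ∘ s≤s , λ j≮l → proj₂ (onS (suc j)) (j≮l ∘ ≤-pred)

  translatedSegment-padded : ∀ {m} x k l → k < l → (g h : Vector Carrier m) →
    (∀ j → (k ≤ toℕ j → toℕ j < l → h j ∙ g j ⁻¹ ≈ x) × (¬ (k ≤ toℕ j × toℕ j < l) → h j ∙ g j ⁻¹ ≈ ε)) →
    TranslatedSegment x (toList g ++ ε ∷ []) (toList h ++ ε ∷ [])
  translatedSegment-padded {zero}  x k l k<l g h onS = prefix (equal (≈-refl ∷ []))
  translatedSegment-padded {suc m} x zero l k<l g h onS =
    prefix (translatedPrefix-padded x l g h
      λ j → proj₁ (onS j) z≤n , λ j≮l → proj₂ (onS j) (j≮l ∘ proj₂))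
  translatedSegment-padded {suc m} x (suc k) (suc l) (s≤s k<l) g h onS =
    x∙y⁻¹≈ε⇒y≈x (proj₂ (onS zero) λ { (() , _) }) ∷
    translatedSegment-padded x k l k<l (tail g) (tail h)
      λ j → (λ k≤j j<l → proj₁ (onS (suc j)) (s≤s k≤j) (s≤s j<l)) ,
            (λ outside → proj₂ (onS (suc j)) λ { (k≤j , j<l) → outside (≤-pred k≤j , ≤-pred j<l) })

lemma3p4 : ∀ {c ℓ} (G : Group c ℓ) (_≟_ : Decidable (Group._≈_ G)) → IsFinite G →
    (m : ℕ) → 1 < m → (g h : Vector (Group.Carrier G) m) →
    ¬ WithGroup.IsIdentity G _≟_ g → ¬ WithGroup.IsIdentity G _≟_ h →
    WithGroup.Adjacent G _≟_ g h →
    ∣ WithGroup.ϑ G _≟_ g - WithGroup.ϑ G _≟_ h ∣ ≤ 2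
lemma3p4 G _≟_ _ _ _ g h g≉e h≉e (x , _ , k , l , k<l , _ , onS) =
  subst₂ (λ u v → ∣ u - v ∣ ≤ 2)
    (≡.sym (suc-weightL≡paddedChanges (toList g) (¬IsIdentity⇒Any≉ε g g≉e)))
    (≡.sym (suc-weightL≡paddedChanges (toList h) (¬IsIdentity⇒Any≉ε h h≉e)))
    (∣changesFrom-changesFrom∣≤2-translatedSegment (translatedSegment-padded x k l k<l g h onS) (Group.refl G))
  where
  open Changes G _≟_
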